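{- Let $\mu=(\mu_0,\dotsc,\mu_\ell)$ be an integer partition with $\ell\geq1$, $1\leq d\leq\mu_0$, $\mu_\ell=1$ and $\mu_{\ell-1}\geq d$. Then for all $n\geq0$, \[ P_{\mu,d,n}(t)=\sum_{j\geq0}\binom{d(n-j\ell)}{j}t^j, \] and $\{P_{\mu,d,n}(t)\}_{n\geq1}$ is a Brenti sequence. In particular every $P_{\mu,d,n}(t)$ has only real nonpositive zeros.
   Context: An anchor word for $\mu$ of length $n$ is a word $a_1\cdots a_n$ over $\{1,\dotsc,d,\infty\}$ such that $a_i\neq\infty$ implies $a_{i+k}\geq a_i+\mu_k$ for $k=1,\dotsc,\ell$ ($\infty$ larger than every integer) and $a_{n-\ell+1}=\cdots=a_n=\infty$; $P_{\mu,d,n}(t)=\sum_w t^{\mathrm{bigtiles}(w)}$ over anchor words of length $n$, where $\mathrm{bigtiles}(w)$ is the number of non-$\infty$ letters. A sequence of polynomials $(P_n)_{n\geq1}$ is a Brenti sequence if there exist a locally finite directed graph $D$ with vertex set $\mathbb{N}^2$ and nonnegative edge weights, which is planar and weakly $y$-invariant (the edges, with weights, leaving $(m,k)$ do not depend on $m$ up to the translation $(m,k)\mapsto(m',k)$), and row indices $r_1,r_2,\dotsc$ such that $P_n(t)=\sum_j M_{r_n,j}t^j$ for all $n$, where $M_{N,j}$ is the weighted number of directed paths from $(0,0)$ to $(N,j)$ in $D$ (a path's weight being the product of its edge weights). -}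

module Defs where

open import Data.Nat using (ℕ; zero; suc; _+_; _*_; _∸_; _≤_; _<_; _≟_; _≤?_)
open import Data.Fin using (Fin; toℕ)
open import Data.Fin.Properties using (all?)
open import Data.Maybe using (Maybe; just; nothing)
open import Data.Vec using (Vec; []; _∷_; lookup)
open import Data.List using (List; []; _∷_; [_]; map; concatMap; filter; length; sum; allFin)
open import Data.List.Relation.Unary.All using (All)
open import Data.List.Relation.Unary.Unique.Propositional using (Unique)
open import Data.List.Membership.Propositional using (_∈_)
open import Data.Product using (Σ; _×_; _,_)
open import Data.Sum using (_⊎_)
open import Data.Unit using (⊤; tt)
open import Relation.Nullary using (Dec; yes; no; ¬_)
open import Relation.Nullary.Decidable using (_×-dec_)
open import Relation.Binary.PropositionalEquality using (_≡_; _≢_)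
open import Data.Rational as ℚ using (ℚ; 0ℚ; 1ℚ)
import Data.Integer as ℤ

-- A letter of {1,…,d,∞}: 'nothing' is ∞, 'just x' is the integer toℕ x + 1.
Letter : ℕ → Set
Letter d = Maybe (Fin d)

Word : ℕ → ℕ → Set
Word d n = Vec (Letter d) n

letters : (d : ℕ) → List (Letter d)
letters d = nothing ∷ map just (allFin d)

allWords : (d n : ℕ) → List (Word d n)
allWords d zero    = [ [] ]
allWords d (suc n) = concatMap (λ a → map (a ∷_) (allWords d n)) (letters d)

-- safe lookup: position i (0-based); positions ≥ n are irrelevant and read as ∞
_!_ : ∀ {d n} → Word d n → ℕ → Letter d
[]      ! _       = nothing
(a ∷ w) ! zero    = a
(a ∷ w) ! (suc i) = w ! i

_≥L_ : ∀ {d} → Letter d → ℕ → Set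
nothing ≥L m = ⊤
just y  ≥L m = m ≤ suc (toℕ y)

AnchorStep : ∀ {d} → Letter d → Letter d → ℕ → Set
AnchorStep nothing  b m = ⊤
AnchorStep (just x) b m = b ≥L (suc (toℕ x) + m)

-- μ = (μ 0, …, μ ℓ) given as a function ℕ → ℕ (values beyond ℓ are ignored).
-- Positions are 0-based: a_{i+1} in the paper is  w ! i.
-- (1) for every position i and k = 1,…,ℓ with i + k in range, the anchor step holds
--     (out-of-range positions read as ∞, so the condition is then vacuous);
-- (2) the last ℓ letters are ∞ (all letters if n < ℓ).
IsAnchor : (ℓ : ℕ) (μ : ℕ → ℕ) {d n : ℕ} → Word d n → Set
IsAnchor ℓ μ {d} {n} w =
  (∀ (i : Fin n) (k : Fin ℓ) →
     AnchorStep (lookup w i) (w ! (toℕ i + suc (toℕ k))) (μ (suc (toℕ k))))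
  × (∀ (i : Fin n) → n ∸ ℓ ≤ toℕ i → lookup w i ≡ nothing)

bigtiles : ∀ {d n} → Word d n → ℕ
bigtiles []             = 0
bigtiles (nothing ∷ w)  = bigtiles w
bigtiles (just _ ∷ w)   = suc (bigtiles w)

≥L? : ∀ {d} (b : Letter d) (m : ℕ) → Dec (b ≥L m)
≥L? nothing  m = yes tt
≥L? (just y) m = m ≤? suc (toℕ y)

AnchorStep? : ∀ {d} (a b : Letter d) (m : ℕ) → Dec (AnchorStep a b m)
AnchorStep? nothing  b m = yes tt
AnchorStep? (just x) b m = ≥L? b (suc (toℕ x) + m)

isNothing? : ∀ {d} (a : Letter d) → Dec (a ≡ nothing)
isNothing? nothing  = yes _≡_.refl
isNothing? (just _) = no (λ ())

impl? : ∀ {A B : Set} → Dec A → Dec B → Dec (A → B)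
impl? _       (yes b) = yes (λ _ → b)
impl? (no ¬a) _       = yes (λ a → Data.Empty.⊥-elim (¬a a))
  where import Data.Empty
impl? (yes a) (no ¬b) = no (λ f → ¬b (f a))

IsAnchor? : (ℓ : ℕ) (μ : ℕ → ℕ) {d n : ℕ} (w : Word d n) → Dec (IsAnchor ℓ μ w)
IsAnchor? ℓ μ {d} {n} w =
  all? (λ i → all? (λ k → AnchorStep? (lookup w i) (w ! (toℕ i + suc (toℕ k))) (μ (suc (toℕ k)))))
  ×-dec all? (λ i → impl? (n ∸ ℓ ≤? toℕ i) (isNothing? (lookup w i)))

-- P_{μ,d,n}(t) = Σ_j (Pcoef ℓ μ d n j) t^j :
-- the number of anchor words of length n with exactly j big tiles.
Pcoef : (ℓ : ℕ) (μ : ℕ → ℕ) (d n j : ℕ) → ℕ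
Pcoef ℓ μ d n j =
  length (filter (λ w → IsAnchor? ℓ μ w ×-dec (bigtiles w ≟ j)) (allWords d n))

IsPartition : (ℓ : ℕ) → (ℕ → ℕ) → Set
IsPartition ℓ μ = (∀ i → i < ℓ → μ (suc i) ≤ μ i) × (∀ i → i ≤ ℓ → 1 ≤ μ i)

Vertex : Set
Vertex = ℕ × ℕ

-- A weighted digraph on ℕ²: W u v is the weight of the edge u → v;
-- there is an edge u → v iff W u v ≠ 0.
Weights : Set
Weights = Vertex → Vertex → ℚ

Edge : Weights → Vertex → Vertex → Set
Edge W u v = W u v ≢ 0ℚ

NonNegative : Weights → Set
NonNegative W = ∀ u v → 0ℚ ℚ.≤ W u v

LocallyFinite : Weights → Set
LocallyFinite W = ∀ u →
  Σ (List Vertex) (λ L → ∀ v → Edge W u v → v ∈ L) ×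
  Σ (List Vertex) (λ L → ∀ v → Edge W v u → v ∈ L)

-- In particular no edge
-- leaving (m,k) goes to a vertex (x,y) with x < m (its translate to m' = 0
-- would leave ℕ²).
WeaklyYInvariant : Weights → Set
WeaklyYInvariant W =
  (∀ m m' k x x' y → x + m' ≡ x' + m → W (m , k) (x , y) ≡ W (m' , k) (x' , y))
  × (∀ m k x y → Edge W (m , k) (x , y) → m ≤ x)

-- Planarity: the digraph drawn in the plane with vertex (m,k) at the point
-- (m,k) and every edge as the straight segment between its endpoints has no
-- crossings: two distinct edges meet only in common endpoints, and no vertex
-- lies on an edge other than at its endpoints.
Point : Set
Point = ℚ × ℚ

pt : Vertex → Point
pt (m , k) = (ℤ.+ m ℚ./ 1 , ℤ.+ k ℚ./ 1)

OnSegment : Point → Vertex → Vertex → Set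
OnSegment (px , py) u v with pt u | pt v
... | (ux , uy) | (vx , vy) =
  Σ ℚ λ s → (0ℚ ℚ.≤ s) × (s ℚ.≤ 1ℚ) ×
    (px ≡ ux ℚ.+ s ℚ.* (vx ℚ.- ux)) × (py ≡ uy ℚ.+ s ℚ.* (vy ℚ.- uy))

Planar : Weights → Set
Planar W =
  (∀ u v u' v' → Edge W u v → Edge W u' v' → ¬ ((u , v) ≡ (u' , v')) →
     ∀ p → OnSegment p u v → OnSegment p u' v' →
       Σ Vertex λ z → (p ≡ pt z) × (z ≡ u ⊎ z ≡ v) × (z ≡ u' ⊎ z ≡ v'))
  × (∀ u v z → Edge W u v → OnSegment (pt z) u v → z ≡ u ⊎ z ≡ v)

-- A directed path from u to t: the list of vertices visited after u.
data IsPath (W : Weights) : Vertex → List Vertex → Vertex → Set where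
  here : ∀ {u} → IsPath W u [] u
  step : ∀ {u v vs t} → Edge W u v → IsPath W v vs t → IsPath W u (v ∷ vs) t

pathWeight : Weights → Vertex → List Vertex → ℚ
pathWeight W u []       = 1ℚ
pathWeight W u (v ∷ vs) = W u v ℚ.* pathWeight W v vs

PathCount : Weights → Vertex → Vertex → ℚ → Set
PathCount W s t c =
  Σ (List (List Vertex)) λ L →
    Unique L × All (λ vs → IsPath W s vs t) L ×
    (∀ vs → IsPath W s vs t → vs ∈ L) ×
    sum' (map (pathWeight W s) L) ≡ c
  where
  sum' : List ℚ → ℚ
  sum' []       = 0ℚ
  sum' (x ∷ xs) = x ℚ.+ sum' xs

BrentiSequence : (ℕ → ℕ → ℕ) → Set
BrentiSequence P =
  Σ Weights λ W → NonNegative W × LocallyFinite W × Planar W × WeaklyYInvariant W ×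
  Σ (ℕ → ℕ) λ r → ∀ n → 1 ≤ n → ∀ j →
    PathCount W (0 , 0) (r n , j) (ℤ.+ (P n j) ℚ./ 1)

{-# OPTIONS --safe #-}
-- Under the hypotheses, μ_k ≥ d for 1 ≤ k < ℓ and μ_ℓ = 1, so the anchor condition says exactly
-- that a letter x ≠ ∞ is followed by ℓ - 1 letters ∞ and then by a letter > x (possibly ∞), and
-- that the last ℓ letters are ∞. Sorting the anchor words of length n with j finite letters and
-- first letter > e by their first letter gives a recurrence which, by Pascal's rule and the
-- hockey-stick identity, is solved by C(d(n - jℓ) - e, j); e = 0 gives the formula.
--
-- For the Brenti property take the graph on ℕ² with unit-weight edges (m,k) → (m+1,k) and
-- (m,k) → (m+dℓ+1,k+1). A path from (0,0) to (N,j) interleaves j long steps with N - (dℓ+1)j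
-- short ones, so there are C(N - dℓj, j) of them, and the rows r_n = dn give P_n. Drawn with
-- straight edges the graph is planar: two edges can only meet at a lattice point, and the only
-- lattice points on an edge are its endpoints.
module Submission where

open import Defs
open import Data.Nat
open import Data.Nat.Properties
open import Data.Nat.Combinatorics using (_C_; nCk+nC[k+1]≡[n+1]C[k+1])
open import Data.Nat.Induction using (<-rec)
open import Data.Nat.ListAction using (sum)
open import Data.Nat.ListAction.Properties using (sum-++)
open import Data.Bool using (if_then_else_)
open import Data.Fin using (Fin; zero; suc; toℕ; fromℕ; fromℕ<)
open import Data.Fin.Properties using (toℕ<n; toℕ-fromℕ; toℕ-fromℕ<)
open import Data.Maybe using (just; nothing)
open import Data.Vec using ([]; _∷_; lookup)
open import Data.List using ([_]; List; []; _∷_; map; filter; length; _++_; allFin; tabulate; applyUpTo; concatMap)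
open import Data.List.Properties using (map-∘; map-cong; map-tabulate; map-++; length-++; length-map; ∷-injective; ∷-injectiveʳ)
open import Data.List.Membership.Propositional using (_∈_)
open import Data.List.Relation.Unary.Any using (here; there)
open import Data.List.Membership.Propositional.Properties using (∈-++⁺ˡ; ∈-++⁺ʳ; ∈-++⁻; ∈-map⁺; map∷⁻; []∉map∷)
open import Data.List.Relation.Unary.All as All using (All; []; _∷_)
import Data.List.Relation.Unary.All.Properties as All
open import Data.List.Relation.Unary.Unique.Propositional using (Unique)
import Data.List.Relation.Unary.Unique.Propositional.Properties as Unique
open import Data.List.Relation.Unary.AllPairs using ([]; _∷_)
open import Data.Product using (Σ; _×_; _,_; proj₁; proj₂)
open import Data.Product.Properties using (≡-dec; ,-injective)
open import Data.Sum using (_⊎_; inj₁; inj₂)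
import Data.Sum as Sum
open import Data.Empty using (⊥; ⊥-elim)
open import Data.Unit using (tt)
open import Function using (_∘_; _⇔_; mk⇔; Equivalence)
open import Relation.Nullary using (Dec; yes; no; does; ¬_)
open import Relation.Nullary.Decidable using (_×-dec_; _⊎-dec_)
open import Relation.Unary using (Decidable)
open import Relation.Binary.PropositionalEquality hiding ([_])
import Data.Integer as ℤ
import Data.Integer.Properties as ℤP
open import Data.Rational as ℚ using (ℚ; 0ℚ; 1ℚ)
import Data.Rational.Properties as ℚP
import Data.Rational.Unnormalised as ℚᵘ
import Data.Rational.Unnormalised.Properties as ℚᵘP
open import Data.Rational.Solver using (module +-*-Solver)
open import Algebra.Properties.Group ℚP.+-0-group using () renaming (∙-cancelˡ to ℚ-+-cancelˡ; ∙-cancelʳ to ℚ-+-cancelʳ)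
open import Relation.Binary.Definitions using (Tri; tri<; tri≈; tri>)

open Equivalence using (to; from)

indicator : {X A : Set} → X → X → Dec A → X
indicator on off a = if does a then on else off

module _ {X : Set} {on off : X} where

  indicator-cong : {A B : Set} → A ⇔ B → (a : Dec A) (b : Dec B) → indicator on off a ≡ indicator on off b
  indicator-cong A⇔B (yes _) (yes _) = refl
  indicator-cong A⇔B (yes a) (no ¬b) = ⊥-elim (¬b (to A⇔B a))
  indicator-cong A⇔B (no ¬a) (yes b) = ⊥-elim (¬a (from A⇔B b))
  indicator-cong A⇔B (no _)  (no _)  = refl

  indicator-yes : {A : Set} → A → (a : Dec A) → indicator on off a ≡ on
  indicator-yes x (yes _) = refl
  indicator-yes x (no ¬x) = ⊥-elim (¬x x)

  indicator-no : {A : Set} → ¬ A → (a : Dec A) → indicator on off a ≡ off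
  indicator-no ¬x (yes x) = ⊥-elim (¬x x)
  indicator-no ¬x (no _)  = refl

⟦_⟧ : {A : Set} → Dec A → ℕ
⟦_⟧ = indicator 1 0

⟦⟧-×-dec : {A B : Set} (a : Dec A) (b : Dec B) → ⟦ a ×-dec b ⟧ ≡ ⟦ a ⟧ * ⟦ b ⟧
⟦⟧-×-dec (yes _) (yes _) = refl
⟦⟧-×-dec (yes _) (no _)  = refl
⟦⟧-×-dec (no _)  (yes _) = refl
⟦⟧-×-dec (no _)  (no _)  = refl

length-filter≡sum-⟦⟧ : {A : Set} {P : A → Set} (P? : Decidable P) (xs : List A) →
  length (filter P? xs) ≡ sum (map (λ x → ⟦ P? x ⟧) xs)
length-filter≡sum-⟦⟧ P? [] = refl
length-filter≡sum-⟦⟧ P? (x ∷ xs) with P? x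
... | yes _ = cong suc (length-filter≡sum-⟦⟧ P? xs)
... | no _  = length-filter≡sum-⟦⟧ P? xs

module _ {A : Set} where

  sum-map-cong : {f g : A → ℕ} → (∀ x → f x ≡ g x) → ∀ xs → sum (map f xs) ≡ sum (map g xs)
  sum-map-cong f≗g xs = cong sum (map-cong f≗g xs)

  sum-map-0 : {f : A → ℕ} → (∀ x → f x ≡ 0) → ∀ xs → sum (map f xs) ≡ 0
  sum-map-0 f≗0 []       = refl
  sum-map-0 f≗0 (x ∷ xs) = cong₂ _+_ (f≗0 x) (sum-map-0 f≗0 xs)

  sum-map-*ˡ : ∀ k (f : A → ℕ) xs → sum (map (λ x → k * f x) xs) ≡ k * sum (map f xs)
  sum-map-*ˡ k f []       = sym (*-zeroʳ k)
  sum-map-*ˡ k f (x ∷ xs) = trans (cong (k * f x +_) (sum-map-*ˡ k f xs)) (sym (*-distribˡ-+ k (f x) _))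

tabulate-toℕ : ∀ {A : Set} n (g : ℕ → A) → tabulate {n = n} (g ∘ toℕ) ≡ applyUpTo g n
tabulate-toℕ zero    g = refl
tabulate-toℕ (suc n) g = cong (g 0 ∷_) (tabulate-toℕ n (g ∘ suc))

sum-allFin : ∀ n (g : ℕ → ℕ) → sum (map (g ∘ toℕ) (allFin n)) ≡ sum (applyUpTo g n)
sum-allFin n g = cong sum (trans (map-tabulate {n = n} (λ i → i) (g ∘ toℕ)) (tabulate-toℕ n g))

sum-applyUpTo-0 : ∀ {f : ℕ → ℕ} → (∀ x → f x ≡ 0) → ∀ n → sum (applyUpTo f n) ≡ 0
sum-applyUpTo-0 f≗0 zero    = refl
sum-applyUpTo-0 f≗0 (suc n) = cong₂ _+_ (f≗0 0) (sum-applyUpTo-0 (f≗0 ∘ suc) n)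

sum-applyUpTo-cong : ∀ {f g : ℕ → ℕ} → (∀ x → f x ≡ g x) → ∀ n → sum (applyUpTo f n) ≡ sum (applyUpTo g n)
sum-applyUpTo-cong f≗g zero    = refl
sum-applyUpTo-cong f≗g (suc n) = cong₂ _+_ (f≗g 0) (sum-applyUpTo-cong (f≗g ∘ suc) n)

-- Binomial identities

⟦1+m≤?1+n⟧ : ∀ m n → ⟦ suc m ≤? suc n ⟧ ≡ ⟦ m ≤? n ⟧
⟦1+m≤?1+n⟧ m n = indicator-cong (mk⇔ s≤s⁻¹ s≤s) (suc m ≤? suc n) (m ≤? n)

-- Truncated subtraction breaks the identity when i = 0 and M < d: then every (M ∸ suc x) C 0
-- is still 1.
hockey-stick : ∀ d M e i → e ≤ d → (i ≡ 0 → d ≤ M) →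
  sum (applyUpTo (λ x → ⟦ e ≤? x ⟧ * ((M ∸ suc x) C i)) d) + (M ∸ d) C suc i ≡ (M ∸ e) C suc i
hockey-stick zero    M       zero    i       _         _      = refl
hockey-stick (suc d) zero    e       zero    _         d≤M    with () ← d≤M refl
hockey-stick (suc d) zero    e       (suc i) _         _      =
  trans (+-identityʳ _) (trans (sum-applyUpTo-0 (λ x → *-zeroʳ ⟦ e ≤? x ⟧) (suc d))
                               (sym (cong (_C suc (suc i)) (0∸n≡0 e))))
hockey-stick (suc d) (suc M) zero    i       _         d≤M    = begin
  sum (applyUpTo (λ x → ⟦ 0 ≤? x ⟧ * ((suc M ∸ suc x) C i)) (suc d)) + (suc M ∸ suc d) C suc i
    ≡⟨ +-assoc (1 * (M C i)) _ _ ⟩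
  1 * (M C i) + (sum (applyUpTo (λ x → ⟦ 0 ≤? x ⟧ * ((M ∸ suc x) C i)) d) + (M ∸ d) C suc i)
    ≡⟨ cong₂ _+_ (*-identityˡ (M C i)) (hockey-stick d M zero i z≤n (s≤s⁻¹ ∘ d≤M)) ⟩
  M C i + M C suc i
    ≡⟨ nCk+nC[k+1]≡[n+1]C[k+1] M i ⟩
  suc M C suc i ∎
  where open ≡-Reasoning
hockey-stick (suc d) (suc M) (suc e) i       (s≤s e≤d) d≤M    = begin
  sum (applyUpTo (λ x → ⟦ suc e ≤? suc x ⟧ * ((M ∸ suc x) C i)) d) + (M ∸ d) C suc i
    ≡⟨ cong (_+ (M ∸ d) C suc i) (sum-applyUpTo-cong (λ x → cong (_* ((M ∸ suc x) C i)) (⟦1+m≤?1+n⟧ e x)) d) ⟩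
  sum (applyUpTo (λ x → ⟦ e ≤? x ⟧ * ((M ∸ suc x) C i)) d) + (M ∸ d) C suc i
    ≡⟨ hockey-stick d M e i e≤d (s≤s⁻¹ ∘ d≤M) ⟩
  (M ∸ e) C suc i ∎
  where open ≡-Reasoning

m*[n∸o]≡m*[1+n∸o]∸m : ∀ d n T → d * (n ∸ T) ≡ d * (suc n ∸ T) ∸ d
m*[n∸o]≡m*[1+n∸o]∸m d n T = begin
  d * (n ∸ T)               ≡⟨ cong (λ s → d * (suc n ∸ s)) (+-comm 1 T) ⟩
  d * (suc n ∸ (T + 1))     ≡⟨ cong (d *_) (sym (∸-+-assoc (suc n) T 1)) ⟩
  d * (suc n ∸ T ∸ 1)       ≡⟨ *-distribˡ-∸ d (suc n ∸ T) 1 ⟩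
  d * (suc n ∸ T) ∸ d * 1   ≡⟨ cong (d * (suc n ∸ T) ∸_) (*-identityʳ d) ⟩
  d * (suc n ∸ T) ∸ d       ∎
  where open ≡-Reasoning

module ClosedForm (c d : ℕ) where

  ℓ : ℕ
  ℓ = suc c

  closedForm : ℕ → ℕ → ℕ → ℕ
  closedForm n j e = (d * (n ∸ j * ℓ) ∸ e) C j

  closedForm-suc-short : ∀ n j e → n < ℓ → closedForm (suc n) (suc j) e ≡ closedForm n (suc j) 0
  closedForm-suc-short n j e n<ℓ =
    trans (vanishes (suc n) e (≤-trans n<ℓ (m≤m+n ℓ (j * ℓ))))
          (sym (vanishes n 0 (≤-trans (<⇒≤ n<ℓ) (m≤m+n ℓ (j * ℓ)))))
    where
    vanishes : ∀ m e → m ≤ suc j * ℓ → (d * (m ∸ suc j * ℓ) ∸ e) C suc j ≡ 0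
    vanishes m e m≤ rewrite m≤n⇒m∸n≡0 m≤ | *-zeroʳ d | 0∸n≡0 e = refl

  closedForm-suc : ∀ n j e → ℓ ≤ n → e ≤ d →
    closedForm (suc n) (suc j) e ≡
      closedForm n (suc j) 0 + sum (map (λ x → ⟦ e ≤? toℕ x ⟧ * closedForm (n ∸ c) j (suc (toℕ x))) (allFin d))
  closedForm-suc n j e ℓ≤n e≤d = begin
    (M ∸ e) C suc j
      ≡⟨ hockey-stick d M e j e≤d d≤M ⟨
    sum (applyUpTo (λ x → ⟦ e ≤? x ⟧ * ((M ∸ suc x) C j)) d) + (M ∸ d) C suc j
      ≡⟨ +-comm _ ((M ∸ d) C suc j) ⟩
    (M ∸ d) C suc j + sum (applyUpTo (λ x → ⟦ e ≤? x ⟧ * ((M ∸ suc x) C j)) d)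
      ≡⟨ cong₂ _+_ (cong (_C suc j) (sym (m*[n∸o]≡m*[1+n∸o]∸m d n (suc j * ℓ))))
                   (sym (trans (sum-map-cong shorter (allFin d)) (sum-allFin d _))) ⟩
    closedForm n (suc j) 0 + sum (map (λ x → ⟦ e ≤? toℕ x ⟧ * closedForm (n ∸ c) j (suc (toℕ x))) (allFin d)) ∎
    where
    open ≡-Reasoning
    M : ℕ
    M = d * (suc n ∸ suc j * ℓ)
    shorter : ∀ (x : Fin d) → ⟦ e ≤? toℕ x ⟧ * closedForm (n ∸ c) j (suc (toℕ x))
                             ≡ ⟦ e ≤? toℕ x ⟧ * ((M ∸ suc (toℕ x)) C j)
    shorter x = cong (λ m → ⟦ e ≤? toℕ x ⟧ * ((d * m ∸ suc (toℕ x)) C j)) (∸-+-assoc n c (j * ℓ))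
    d≤M : j ≡ 0 → d ≤ M
    d≤M refl rewrite +-∸-assoc 1 (subst (_≤ n) (sym (+-identityʳ ℓ)) ℓ≤n) = m≤m*n d (suc (n ∸ (ℓ + 0)))

pascal-∸ : ∀ r q b → (b ≡ 0 → q ≡ 0) → (r ∸ q) C suc b + (r ∸ q) C b ≡ (suc r ∸ q) C suc b
pascal-∸ r q b b≡0⇒q≡0 with q ≤? r
... | yes q≤r rewrite +-∸-assoc 1 q≤r = trans (+-comm _ ((r ∸ q) C b)) (nCk+nC[k+1]≡[n+1]C[k+1] (r ∸ q) b)
... | no q≰r with b
...   | suc _ rewrite m≤n⇒m∸n≡0 (<⇒≤ (≰⇒> q≰r)) | m≤n⇒m∸n≡0 (≰⇒> q≰r) = refl
...   | zero  = ⊥-elim (q≰r (subst (_≤ r) (sym (b≡0⇒q≡0 refl)) z≤n))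

lattice-pascal : ∀ t a b → t ≤ a →
  (a ∸ t * suc b) C suc b + ((a ∸ t) ∸ t * b) C b ≡ (suc a ∸ t * suc b) C suc b
lattice-pascal t a b t≤a
  rewrite *-suc t b | sym (∸-+-assoc a t (t * b)) | sym (∸-+-assoc (suc a) t (t * b)) | +-∸-assoc 1 t≤a =
  pascal-∸ (a ∸ t) (t * b) b (λ { refl → *-zeroʳ t })

lattice-pascal-short : ∀ t a b → a < t → (a ∸ t * suc b) C suc b ≡ (suc a ∸ t * suc b) C suc b
lattice-pascal-short t a b a<t
  rewrite m≤n⇒m∸n≡0 (≤-trans (<⇒≤ a<t) (m≤m*n t (suc b))) | m≤n⇒m∸n≡0 (≤-trans a<t (m≤m*n t (suc b))) = refl

-- Anchor words

module WordSums (d : ℕ) where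

  sumWords : ∀ n → (Word d n → ℕ) → ℕ
  sumWords n f = sum (map f (allWords d n))

  sumWords-cong : ∀ n {f g : Word d n → ℕ} → (∀ w → f w ≡ g w) → sumWords n f ≡ sumWords n g
  sumWords-cong n f≗g = sum-map-cong f≗g (allWords d n)

  sumWords-⟦⟧-cong : ∀ n {P Q : Word d n → Set} (P? : ∀ w → Dec (P w)) (Q? : ∀ w → Dec (Q w)) →
    (∀ w → P w ⇔ Q w) → sumWords n (λ w → ⟦ P? w ⟧) ≡ sumWords n (λ w → ⟦ Q? w ⟧)
  sumWords-⟦⟧-cong n P? Q? P⇔Q = sumWords-cong n (λ w → indicator-cong (P⇔Q w) (P? w) (Q? w))

  sumWords-0 : ∀ n {f : Word d n → ℕ} → (∀ w → f w ≡ 0) → sumWords n f ≡ 0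
  sumWords-0 n f≗0 = sum-map-0 f≗0 (allWords d n)

  sumWords-*ˡ : ∀ n k (f : Word d n → ℕ) → sumWords n (λ w → k * f w) ≡ k * sumWords n f
  sumWords-*ˡ n k f = sum-map-*ˡ k f (allWords d n)

  sumWords-suc : ∀ n (f : Word d (suc n) → ℕ) →
    sumWords (suc n) f ≡
      sumWords n (λ w → f (nothing ∷ w)) + sum (map (λ x → sumWords n (λ w → f (just x ∷ w))) (allFin d))
  sumWords-suc n f = trans (byFirstLetter (letters d)) (cong (sumWords n (λ w → f (nothing ∷ w)) +_)
                                                     (cong sum (sym (map-∘ (allFin d)))))
    where
    byFirstLetter : ∀ as → sum (map f (concatMap (λ a → map (a ∷_) (allWords d n)) as))
                           ≡ sum (map (λ a → sumWords n (λ w → f (a ∷ w))) as)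
    byFirstLetter []       = refl
    byFirstLetter (a ∷ as) =
      trans (cong sum (map-++ f (map (a ∷_) (allWords d n)) _))
        (trans (sum-++ (map f (map (a ∷_) (allWords d n))) _)
          (cong₂ _+_ (cong sum (sym (map-∘ (allWords d n)))) (byFirstLetter as)))

  BlanksThen : ℕ → (∀ {m} → Word d m → Set) → ∀ {n} → Word d n → Set
  BlanksThen zero    Q w             = Q w
  BlanksThen (suc c) Q (nothing ∷ w) = BlanksThen c Q w
  BlanksThen (suc c) Q _             = ⊥

  blanksThen? : ∀ c {Q : ∀ {m} → Word d m → Set} → (∀ {m} (w : Word d m) → Dec (Q w)) →
    ∀ {n} (w : Word d n) → Dec (BlanksThen c Q w)
  blanksThen? zero    Q? w             = Q? w
  blanksThen? (suc c) Q? []            = no λ ()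
  blanksThen? (suc c) Q? (nothing ∷ w) = blanksThen? c Q? w
  blanksThen? (suc c) Q? (just _ ∷ w)  = no λ ()

  sumWords-blanksThen : ∀ c n {Q : ∀ {m} → Word d m → Set} (Q? : ∀ {m} (w : Word d m) → Dec (Q w)) →
    c ≤ n → sumWords n (λ w → ⟦ blanksThen? c Q? w ⟧) ≡ sumWords (n ∸ c) (λ w → ⟦ Q? w ⟧)
  sumWords-blanksThen zero    n       Q? _         = refl
  sumWords-blanksThen (suc c) (suc n) Q? (s≤s c≤n) = begin
    sumWords (suc n) (λ w → ⟦ blanksThen? (suc c) Q? w ⟧)
      ≡⟨ sumWords-suc n _ ⟩
    sumWords n (λ w → ⟦ blanksThen? c Q? w ⟧) + sum (map (λ _ → sumWords n (λ _ → 0)) (allFin d))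
      ≡⟨ cong₂ _+_ (sumWords-blanksThen c n Q? c≤n) (sum-map-0 (λ _ → sumWords-0 n (λ _ → refl)) (allFin d)) ⟩
    sumWords (n ∸ c) (λ w → ⟦ Q? w ⟧) + 0
      ≡⟨ +-identityʳ _ ⟩
    sumWords (n ∸ c) (λ w → ⟦ Q? w ⟧) ∎
    where open ≡-Reasoning

[1+m]∸n≤1+o⇔m∸n≤o : ∀ m n o → suc m ∸ n ≤ suc o ⇔ m ∸ n ≤ o
[1+m]∸n≤1+o⇔m∸n≤o m       zero    o = mk⇔ s≤s⁻¹ s≤s
[1+m]∸n≤1+o⇔m∸n≤o zero    (suc n) o = mk⇔ (λ _ → z≤n) (λ _ → subst (_≤ suc o) (sym (0∸n≡0 n)) z≤n)
[1+m]∸n≤1+o⇔m∸n≤o (suc m) (suc n) o = [1+m]∸n≤1+o⇔m∸n≤o m n o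

[1+m]∸n≤0⇔m<n : ∀ m n → suc m ∸ n ≤ 0 ⇔ m < n
[1+m]∸n≤0⇔m<n m n = mk⇔ (λ le → m∸n≡0⇒m≤n (n≤0⇒n≡0 le)) (λ lt → ≤-reflexive (m≤n⇒m∸n≡0 lt))

module Anchors (ℓ : ℕ) (μ : ℕ → ℕ) (d : ℕ) where

  open WordSums d using (sumWords; sumWords-⟦⟧-cong; sumWords-suc; sumWords-0; BlanksThen)

  HeadCondition : ∀ {n} → Letter d → Word d n → Set
  HeadCondition {n} a w = (∀ (k : Fin ℓ) → AnchorStep a (w ! toℕ k) (μ (suc (toℕ k)))) × (n < ℓ → a ≡ nothing)

  headCondition-nothing : ∀ {n} (w : Word d n) → HeadCondition nothing w
  headCondition-nothing w = (λ _ → tt) , (λ _ → refl)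

  isAnchor-∷ : ∀ {n} (a : Letter d) (w : Word d n) → IsAnchor ℓ μ (a ∷ w) ⇔ (IsAnchor ℓ μ w × HeadCondition a w)
  isAnchor-∷ {n} a w = mk⇔
    (λ (steps , tail) →
      ((λ i → steps (suc i)) , (λ i le → tail (suc i) (from (shift i) le))) ,
      steps zero , (λ n<ℓ → tail zero (from ([1+m]∸n≤0⇔m<n n ℓ) n<ℓ)))
    (λ ((steps , tail) , (headSteps , short)) → stepsAt steps headSteps , tailAt tail short)
    where
    shift : ∀ (i : Fin n) → suc n ∸ ℓ ≤ suc (toℕ i) ⇔ n ∸ ℓ ≤ toℕ i
    shift i = [1+m]∸n≤1+o⇔m∸n≤o n ℓ (toℕ i)
    stepsAt : (∀ (i : Fin n) (k : Fin ℓ) → AnchorStep (lookup w i) (w ! (toℕ i + suc (toℕ k))) (μ (suc (toℕ k)))) →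
              (∀ (k : Fin ℓ) → AnchorStep a (w ! toℕ k) (μ (suc (toℕ k)))) →
              ∀ (i : Fin (suc n)) (k : Fin ℓ) →
                AnchorStep (lookup (a ∷ w) i) ((a ∷ w) ! (toℕ i + suc (toℕ k))) (μ (suc (toℕ k)))
    stepsAt steps headSteps zero    k = headSteps k
    stepsAt steps headSteps (suc i) k = steps i k
    tailAt : (∀ (i : Fin n) → n ∸ ℓ ≤ toℕ i → lookup w i ≡ nothing) → (n < ℓ → a ≡ nothing) →
             ∀ (i : Fin (suc n)) → suc n ∸ ℓ ≤ toℕ i → lookup (a ∷ w) i ≡ nothing
    tailAt tail short zero    le = short (to ([1+m]∸n≤0⇔m<n n ℓ) le)
    tailAt tail short (suc i) le = tail i (to (shift i) le)

  AnchorAbove : ℕ → ℕ → ∀ {n} → Word d n → Set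
  AnchorAbove j e w = IsAnchor ℓ μ w × bigtiles w ≡ j × (w ! 0) ≥L suc e

  anchorAbove? : ∀ j e {n} (w : Word d n) → Dec (AnchorAbove j e w)
  anchorAbove? j e w = IsAnchor? ℓ μ w ×-dec (bigtiles w ≟ j) ×-dec ≥L? (w ! 0) (suc e)

  anchorAbove-0 : ∀ j {n} (w : Word d n) → (IsAnchor ℓ μ w × bigtiles w ≡ j) ⇔ AnchorAbove j 0 w
  anchorAbove-0 j w = mk⇔ (λ (anchor , tiles) → anchor , tiles , firstLetter w) (λ (anchor , tiles , _) → anchor , tiles)
    where
    firstLetter : ∀ {n} (w : Word d n) → (w ! 0) ≥L 1
    firstLetter []           = tt
    firstLetter (nothing ∷ w) = tt
    firstLetter (just _ ∷ w)  = s≤s z≤n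

  anchorAbove-nothing∷ : ∀ j e {n} (w : Word d n) → AnchorAbove j e (nothing ∷ w) ⇔ AnchorAbove j 0 w
  anchorAbove-nothing∷ j e w = mk⇔
    (λ (anchor , tiles , _) → to (anchorAbove-0 j w) (proj₁ (to (isAnchor-∷ nothing w) anchor) , tiles))
    (λ (anchor , tiles , _) → from (isAnchor-∷ nothing w) (anchor , headCondition-nothing w) , tiles , tt)

  anchorAbove-just∷-0 : ∀ e {n} x (w : Word d n) → ¬ AnchorAbove 0 e (just x ∷ w)
  anchorAbove-just∷-0 e x w (_ , () , _)

  anchorAbove-just∷-short : ∀ j e {n} x (w : Word d n) → n < ℓ → ¬ AnchorAbove j e (just x ∷ w)
  anchorAbove-just∷-short j e x w n<ℓ (anchor , _) with proj₂ (proj₂ (to (isAnchor-∷ (just x) w) anchor)) n<ℓ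
  ... | ()

  Blank : ℕ → ∀ {n} → Word d n → Set
  Blank c w = ∀ k → k < c → w ! k ≡ nothing

  blankPrefix⇔blanksThen : ∀ c j e {n} (w : Word d n) → c < n →
    (Blank c w × IsAnchor ℓ μ w × bigtiles w ≡ j × (w ! c) ≥L suc e) ⇔ BlanksThen c (AnchorAbove j e) w
  blankPrefix⇔blanksThen c j e w c<n = mk⇔ (toBlanksThen c w c<n) (fromBlanksThen c w)
    where
    toBlanksThen : ∀ c {n} (w : Word d n) → c < n →
      Blank c w × IsAnchor ℓ μ w × bigtiles w ≡ j × (w ! c) ≥L suc e → BlanksThen c (AnchorAbove j e) w
    toBlanksThen zero    w             _          (_ , rest) = rest
    toBlanksThen (suc c) (nothing ∷ w) (s≤s c<n) (blank , anchor , tiles , above) =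
      toBlanksThen c w c<n
        ((λ k k<c → blank (suc k) (s≤s k<c)) , proj₁ (to (isAnchor-∷ nothing w) anchor) , tiles , above)
    toBlanksThen (suc c) (just _ ∷ w)  _          (blank , _) with blank 0 (s≤s z≤n)
    ... | ()

    fromBlanksThen : ∀ c {n} (w : Word d n) →
      BlanksThen c (AnchorAbove j e) w → Blank c w × IsAnchor ℓ μ w × bigtiles w ≡ j × (w ! c) ≥L suc e
    fromBlanksThen zero    w             rest = (λ _ ()) , rest
    fromBlanksThen (suc c) (nothing ∷ w) rest with fromBlanksThen c w rest
    ... | blank , anchor , tiles , above =
      blank′ , from (isAnchor-∷ nothing w) (anchor , headCondition-nothing w) , tiles , above
      where
      blank′ : Blank (suc c) (nothing ∷ w)
      blank′ zero    _         = refl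
      blank′ (suc k) (s≤s k<c) = blank k k<c

  anchorCount : ℕ → ℕ → ℕ → ℕ
  anchorCount n j e = sumWords n (λ w → ⟦ anchorAbove? j e w ⟧)

  anchorCount-suc-blankHead : ∀ n j e → (∀ x (w : Word d n) → ¬ AnchorAbove j e (just x ∷ w)) →
    anchorCount (suc n) j e ≡ anchorCount n j 0
  anchorCount-suc-blankHead n j e noJust = begin
    anchorCount (suc n) j e
      ≡⟨ sumWords-suc n _ ⟩
    sumWords n (λ w → ⟦ anchorAbove? j e (nothing ∷ w) ⟧)
      + sum (map (λ x → sumWords n (λ w → ⟦ anchorAbove? j e (just x ∷ w) ⟧)) (allFin d))
      ≡⟨ cong₂ _+_ (sumWords-⟦⟧-cong n (λ w → anchorAbove? j e (nothing ∷ w)) (anchorAbove? j 0) (anchorAbove-nothing∷ j e))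
                   (sum-map-0 (λ x → sumWords-0 n (λ w → indicator-no (noJust x w) (anchorAbove? j e (just x ∷ w))))
                              (allFin d)) ⟩
    anchorCount n j 0 + 0
      ≡⟨ +-identityʳ _ ⟩
    anchorCount n j 0 ∎
    where open ≡-Reasoning

≥L-beyond : ∀ {d} (b : Letter d) m → d ≤ m → b ≥L suc m → b ≡ nothing
≥L-beyond nothing  m d≤m _    = refl
≥L-beyond (just y) m d≤m m<y = ⊥-elim (<⇒≱ (toℕ<n y) (≤-trans d≤m (s≤s⁻¹ m<y)))

module AnchorCount (c : ℕ) (μ : ℕ → ℕ) (d : ℕ)
  (μ-large : ∀ k → k < c → d ≤ μ (suc k)) (μ-last : μ (suc c) ≡ 1) where

  ℓ : ℕ
  ℓ = suc c

  open Anchors ℓ μ d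
  open WordSums d

  anchorSteps⇔blankPrefix : ∀ {n} (x : Fin d) (w : Word d n) →
    (∀ (k : Fin ℓ) → AnchorStep (just x) (w ! toℕ k) (μ (suc (toℕ k)))) ⇔ (Blank c w × (w ! c) ≥L suc (suc (toℕ x)))
  anchorSteps⇔blankPrefix x w = mk⇔ (λ steps → blank steps , last steps) fromBlankPrefix
    where
    blank : (∀ (k : Fin ℓ) → AnchorStep (just x) (w ! toℕ k) (μ (suc (toℕ k)))) → Blank c w
    blank steps k k<c = ≥L-beyond (w ! k) (toℕ x + μ (suc k)) (≤-trans (μ-large k k<c) (m≤n+m _ (toℕ x)))
      (subst (λ i → (w ! i) ≥L (suc (toℕ x) + μ (suc i))) (toℕ-fromℕ< k<ℓ) (steps (fromℕ< k<ℓ)))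
      where
      k<ℓ : k < ℓ
      k<ℓ = m<n⇒m<1+n k<c
    last : (∀ (k : Fin ℓ) → AnchorStep (just x) (w ! toℕ k) (μ (suc (toℕ k)))) → (w ! c) ≥L suc (suc (toℕ x))
    last steps with steps (fromℕ c)
    ... | lastStep rewrite toℕ-fromℕ c | μ-last = subst ((w ! c) ≥L_) (+-comm (suc (toℕ x)) 1) lastStep
    fromBlankPrefix : Blank c w × (w ! c) ≥L suc (suc (toℕ x)) →
      ∀ (k : Fin ℓ) → AnchorStep (just x) (w ! toℕ k) (μ (suc (toℕ k)))
    fromBlankPrefix (blank , last) k with m≤n⇒m<n∨m≡n (s≤s⁻¹ (toℕ<n k))
    ... | inj₁ k<c rewrite blank (toℕ k) k<c = tt
    ... | inj₂ k≡c rewrite k≡c | μ-last = subst ((w ! c) ≥L_) (+-comm 1 (suc (toℕ x))) last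

  anchorAbove-just∷ : ∀ j e {n} x (w : Word d n) → ℓ ≤ n →
    AnchorAbove (suc j) e (just x ∷ w) ⇔ (e ≤ toℕ x × BlanksThen c (AnchorAbove j (suc (toℕ x))) w)
  anchorAbove-just∷ j e x w ℓ≤n = mk⇔
    (λ (anchor , tiles , above) →
      let (anchorW , headSteps , _) = to (isAnchor-∷ (just x) w) anchor
          (blank , last) = to (anchorSteps⇔blankPrefix x w) headSteps
      in s≤s⁻¹ above , to prefix (blank , anchorW , suc-injective tiles , last))
    (λ (e≤x , blanksThen) →
      let (blank , anchorW , tiles , last) = from prefix blanksThen
      in from (isAnchor-∷ (just x) w)
           (anchorW , from (anchorSteps⇔blankPrefix x w) (blank , last) , λ n<ℓ → ⊥-elim (<⇒≱ n<ℓ ℓ≤n)) ,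
         cong suc tiles , s≤s e≤x)
    where
    prefix : (Blank c w × IsAnchor ℓ μ w × bigtiles w ≡ j × (w ! c) ≥L suc (suc (toℕ x)))
             ⇔ BlanksThen c (AnchorAbove j (suc (toℕ x))) w
    prefix = blankPrefix⇔blanksThen c j (suc (toℕ x)) w ℓ≤n

  anchorCount-suc : ∀ n j e → ℓ ≤ n →
    anchorCount (suc n) (suc j) e ≡
      anchorCount n (suc j) 0 + sum (map (λ x → ⟦ e ≤? toℕ x ⟧ * anchorCount (n ∸ c) j (suc (toℕ x))) (allFin d))
  anchorCount-suc n j e ℓ≤n = trans (sumWords-suc n _)
    (cong₂ _+_ (sumWords-⟦⟧-cong n (λ w → anchorAbove? (suc j) e (nothing ∷ w)) (anchorAbove? (suc j) 0)
                                   (anchorAbove-nothing∷ (suc j) e))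
               (sum-map-cong startingWith (allFin d)))
    where
    open ≡-Reasoning
    startingWith : ∀ x → sumWords n (λ w → ⟦ anchorAbove? (suc j) e (just x ∷ w) ⟧)
                         ≡ ⟦ e ≤? toℕ x ⟧ * anchorCount (n ∸ c) j (suc (toℕ x))
    startingWith x = begin
      sumWords n (λ w → ⟦ anchorAbove? (suc j) e (just x ∷ w) ⟧)
        ≡⟨ sumWords-⟦⟧-cong n (λ w → anchorAbove? (suc j) e (just x ∷ w))
                              (λ w → (e ≤? toℕ x) ×-dec blanksThen? c (anchorAbove? j (suc (toℕ x))) w)
                              (λ w → anchorAbove-just∷ j e x w ℓ≤n) ⟩
      sumWords n (λ w → ⟦ (e ≤? toℕ x) ×-dec blanksThen? c (anchorAbove? j (suc (toℕ x))) w ⟧)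
        ≡⟨ sumWords-cong n (λ w → ⟦⟧-×-dec (e ≤? toℕ x) (blanksThen? c (anchorAbove? j (suc (toℕ x))) w)) ⟩
      sumWords n (λ w → ⟦ e ≤? toℕ x ⟧ * ⟦ blanksThen? c (anchorAbove? j (suc (toℕ x))) w ⟧)
        ≡⟨ sumWords-*ˡ n ⟦ e ≤? toℕ x ⟧ _ ⟩
      ⟦ e ≤? toℕ x ⟧ * sumWords n (λ w → ⟦ blanksThen? c (anchorAbove? j (suc (toℕ x))) w ⟧)
        ≡⟨ cong (⟦ e ≤? toℕ x ⟧ *_) (sumWords-blanksThen c n (anchorAbove? j (suc (toℕ x))) (<⇒≤ ℓ≤n)) ⟩
      ⟦ e ≤? toℕ x ⟧ * anchorCount (n ∸ c) j (suc (toℕ x)) ∎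

  open ClosedForm c d using (closedForm; closedForm-suc-short; closedForm-suc)

  anchorCount≡closedForm : ∀ n j e → e ≤ d → anchorCount n j e ≡ closedForm n j e
  anchorCount≡closedForm = <-rec (λ n → ∀ j e → e ≤ d → anchorCount n j e ≡ closedForm n j e) byLength
    where
    byLength : ∀ n → (∀ {m} → m < n → ∀ j e → e ≤ d → anchorCount m j e ≡ closedForm m j e) →
           ∀ j e → e ≤ d → anchorCount n j e ≡ closedForm n j e
    byLength zero    _  zero    e _ = refl
    byLength zero    _  (suc j) e _ rewrite *-zeroʳ d | 0∸n≡0 e = refl
    byLength (suc n) ih zero    e _ =
      trans (anchorCount-suc-blankHead n 0 e (anchorAbove-just∷-0 e)) (ih ≤-refl 0 0 z≤n)
    byLength (suc n) ih (suc j) e e≤d with ℓ ≤? n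
    ... | no n≱ℓ = begin
      anchorCount (suc n) (suc j) e
        ≡⟨ anchorCount-suc-blankHead n (suc j) e (λ x w → anchorAbove-just∷-short (suc j) e x w n<ℓ) ⟩
      anchorCount n (suc j) 0
        ≡⟨ ih ≤-refl (suc j) 0 z≤n ⟩
      closedForm n (suc j) 0
        ≡⟨ closedForm-suc-short n j e n<ℓ ⟨
      closedForm (suc n) (suc j) e ∎
      where
      open ≡-Reasoning
      n<ℓ : n < ℓ
      n<ℓ = ≰⇒> n≱ℓ
    ... | yes ℓ≤n = begin
      anchorCount (suc n) (suc j) e
        ≡⟨ anchorCount-suc n j e ℓ≤n ⟩
      anchorCount n (suc j) 0 + sum (map (λ x → ⟦ e ≤? toℕ x ⟧ * anchorCount (n ∸ c) j (suc (toℕ x))) (allFin d))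
        ≡⟨ cong₂ _+_ (ih ≤-refl (suc j) 0 z≤n)
                     (sum-map-cong (λ x → cong (⟦ e ≤? toℕ x ⟧ *_) (ih (s≤s (m∸n≤m n c)) j (suc (toℕ x)) (toℕ<n x)))
                                   (allFin d)) ⟩
      closedForm n (suc j) 0 + sum (map (λ x → ⟦ e ≤? toℕ x ⟧ * closedForm (n ∸ c) j (suc (toℕ x))) (allFin d))
        ≡⟨ closedForm-suc n j e ℓ≤n e≤d ⟨
      closedForm (suc n) (suc j) e ∎
      where open ≡-Reasoning

  Pcoef≡binomial : ∀ n j → Pcoef ℓ μ d n j ≡ (d * (n ∸ j * ℓ)) C j
  Pcoef≡binomial n j = begin
    Pcoef ℓ μ d n j
      ≡⟨ length-filter≡sum-⟦⟧ (λ w → IsAnchor? ℓ μ w ×-dec (bigtiles w ≟ j)) (allWords d n) ⟩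
    sumWords n (λ w → ⟦ IsAnchor? ℓ μ w ×-dec (bigtiles w ≟ j) ⟧)
      ≡⟨ sumWords-⟦⟧-cong n (λ w → IsAnchor? ℓ μ w ×-dec (bigtiles w ≟ j)) (anchorAbove? j 0) (anchorAbove-0 j) ⟩
    anchorCount n j 0
      ≡⟨ anchorCount≡closedForm n j 0 z≤n ⟩
    closedForm n j 0 ∎
    where open ≡-Reasoning

-- Lattice points in ℚ²

ι : ℕ → ℚ
ι n = ℤ.+ n ℚ./ 1

ιᵘ : ℕ → ℚᵘ.ℚᵘ
ιᵘ n = ℚᵘ.mkℚᵘ (ℤ.+ n) 0

toℚᵘ-ι : ∀ n → ℚ.toℚᵘ (ι n) ℚᵘ.≃ ιᵘ n
toℚᵘ-ι n = ℚP.toℚᵘ-fromℚᵘ (ιᵘ n)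

ιᵘ-+ : ∀ a b → ιᵘ (a + b) ℚᵘ.≃ ιᵘ a ℚᵘ.+ ιᵘ b
ιᵘ-+ a b = ℚᵘ.*≡* (begin
  ℤ.+ (a + b) ℤ.* ℤ.+ 1                             ≡⟨ ℤP.*-identityʳ _ ⟩
  ℤ.+ (a + b)                                       ≡⟨ ℤP.pos-+ a b ⟩
  ℤ.+ a ℤ.+ ℤ.+ b                                   ≡⟨ cong₂ ℤ._+_ (ℤP.*-identityʳ (ℤ.+ a)) (ℤP.*-identityʳ (ℤ.+ b)) ⟨
  ℤ.+ a ℤ.* ℤ.+ 1 ℤ.+ ℤ.+ b ℤ.* ℤ.+ 1               ≡⟨ ℤP.*-identityʳ _ ⟨
  (ℤ.+ a ℤ.* ℤ.+ 1 ℤ.+ ℤ.+ b ℤ.* ℤ.+ 1) ℤ.* ℤ.+ 1 ∎)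
  where open ≡-Reasoning

ι-+ : ∀ a b → ι (a + b) ≡ ι a ℚ.+ ι b
ι-+ a b = ℚP.toℚᵘ-injective (begin
  ℚ.toℚᵘ (ι (a + b))            ≈⟨ toℚᵘ-ι (a + b) ⟩
  ιᵘ (a + b)                    ≈⟨ ιᵘ-+ a b ⟩
  ιᵘ a ℚᵘ.+ ιᵘ b                ≈⟨ ℚᵘP.+-cong (toℚᵘ-ι a) (toℚᵘ-ι b) ⟨
  ℚ.toℚᵘ (ι a) ℚᵘ.+ ℚ.toℚᵘ (ι b) ≈⟨ ℚP.toℚᵘ-homo-+ (ι a) (ι b) ⟨
  ℚ.toℚᵘ (ι a ℚ.+ ι b)          ∎)
  where open ℚᵘP.≃-Reasoning

ι-suc : ∀ n → ι (suc n) ≡ 1ℚ ℚ.+ ι n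
ι-suc = ι-+ 1

ι-mono-≤ : ∀ {a b} → a ≤ b → ι a ℚ.≤ ι b
ι-mono-≤ {a} {b} a≤b = ℚP.toℚᵘ-cancel-≤
  (ℚᵘP.≤-respʳ-≃ (ℚᵘP.≃-sym (toℚᵘ-ι b)) (ℚᵘP.≤-respˡ-≃ (ℚᵘP.≃-sym (toℚᵘ-ι a))
    (ℚᵘ.*≤* (subst₂ ℤ._≤_ (sym (ℤP.*-identityʳ (ℤ.+ a))) (sym (ℤP.*-identityʳ (ℤ.+ b))) (ℤ.+≤+ a≤b)))))

ι-cancel-≤ : ∀ {a b} → ι a ℚ.≤ ι b → a ≤ b
ι-cancel-≤ {a} {b} ιa≤ιb with ℚᵘP.≤-respʳ-≃ (toℚᵘ-ι b) (ℚᵘP.≤-respˡ-≃ (toℚᵘ-ι a) (ℚP.toℚᵘ-mono-≤ ιa≤ιb))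
... | ℚᵘ.*≤* a≤b = ℤP.drop‿+≤+ (subst₂ ℤ._≤_ (ℤP.*-identityʳ (ℤ.+ a)) (ℤP.*-identityʳ (ℤ.+ b)) a≤b)

ι-injective : ∀ {a b} → ι a ≡ ι b → a ≡ b
ι-injective ιa≡ιb = ≤-antisym (ι-cancel-≤ (ℚP.≤-reflexive ιa≡ιb)) (ι-cancel-≤ (ℚP.≤-reflexive (sym ιa≡ιb)))

p≤p+q : ∀ x {s} → 0ℚ ℚ.≤ s → x ℚ.≤ x ℚ.+ s
p≤p+q x 0≤s = subst (ℚ._≤ x ℚ.+ _) (ℚP.+-identityʳ x) (ℚP.+-monoʳ-≤ x 0≤s)

p+q≤1+p : ∀ x {s} → s ℚ.≤ 1ℚ → x ℚ.+ s ℚ.≤ 1ℚ ℚ.+ x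
p+q≤1+p x s≤1 = subst (x ℚ.+ _ ℚ.≤_) (ℚP.+-comm x 1ℚ) (ℚP.+-monoʳ-≤ x s≤1)

ι-unitStep-lower : ∀ {z a s} → ι z ≡ ι a ℚ.+ s → 0ℚ ℚ.≤ s → a ≤ z
ι-unitStep-lower {a = a} ιz≡ιa+s 0≤s = ι-cancel-≤ (subst (ι a ℚ.≤_) (sym ιz≡ιa+s) (p≤p+q (ι a) 0≤s))

ι-unitStep-upper : ∀ {z a s} → ι z ≡ ι a ℚ.+ s → s ℚ.≤ 1ℚ → z ≤ suc a
ι-unitStep-upper {a = a} ιz≡ιa+s s≤1 = ι-cancel-≤ (subst₂ ℚ._≤_ (sym ιz≡ιa+s) (sym (ι-suc a)) (p+q≤1+p (ι a) s≤1))

ι-unitStep : ∀ {z a s} → ι z ≡ ι a ℚ.+ s → 0ℚ ℚ.≤ s → s ℚ.≤ 1ℚ →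
  (z ≡ a × s ≡ 0ℚ) ⊎ (z ≡ suc a × s ≡ 1ℚ)
ι-unitStep {z} {a} {s} ιz≡ιa+s 0≤s s≤1 = endpoint (m≤n⇒m<n∨m≡n (ι-unitStep-upper {z} {a} ιz≡ιa+s s≤1))
  where
  open ≡-Reasoning
  endpoint : z < suc a ⊎ z ≡ suc a → (z ≡ a × s ≡ 0ℚ) ⊎ (z ≡ suc a × s ≡ 1ℚ)
  endpoint (inj₂ z≡1+a) = inj₂ (z≡1+a , ℚ-+-cancelˡ (ι a) s 1ℚ (begin
    ι a ℚ.+ s    ≡⟨ ιz≡ιa+s ⟨
    ι z          ≡⟨ cong ι z≡1+a ⟩
    ι (suc a)    ≡⟨ ι-suc a ⟩
    1ℚ ℚ.+ ι a   ≡⟨ ℚP.+-comm 1ℚ (ι a) ⟩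
    ι a ℚ.+ 1ℚ   ∎))
  endpoint (inj₁ z<1+a) = inj₁ (z≡a , ℚ-+-cancelˡ (ι a) s 0ℚ (begin
    ι a ℚ.+ s    ≡⟨ ιz≡ιa+s ⟨
    ι z          ≡⟨ cong ι z≡a ⟩
    ι a          ≡⟨ ℚP.+-identityʳ (ι a) ⟨
    ι a ℚ.+ 0ℚ   ∎))
    where
    z≡a : z ≡ a
    z≡a = ≤-antisym (s≤s⁻¹ z<1+a) (ι-unitStep-lower {z} {a} ιz≡ιa+s 0≤s)

ι-unitSteps-overlap : ∀ {a b s s′} → a < b → 0ℚ ℚ.≤ s′ → s ℚ.≤ 1ℚ →
  ι a ℚ.+ s ≡ ι b ℚ.+ s′ → ι a ℚ.+ s ≡ ι (suc a)
ι-unitSteps-overlap {a} {b} {s} {s′} a<b 0≤s′ s≤1 meet = ℚP.≤-antisym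
  (subst (ι a ℚ.+ s ℚ.≤_) (sym (ι-suc a)) (p+q≤1+p (ι a) s≤1))
  (ℚP.≤-trans (ι-mono-≤ a<b) (subst (ι b ℚ.≤_) (sym meet) (p≤p+q (ι b) 0≤s′)))

-- The lattice-path graph

-- `PathCount` adds up path weights with a function local to its definition; pattern
-- unification against the unfolded `PathCount` recovers that function.
pathWeightSum : Weights → Vertex → Vertex → ℚ → List (List Vertex) → ℚ
pathWeightSum W s t c = lastSummand (refl {x = PathCount W s t c})
  where
  lastSummand : {A : Set} {U V X : A → Set} {f : A → ℚ} {c : ℚ} →
    (Σ A λ L → U L × V L × X L × f L ≡ c) ≡ (Σ A λ L → U L × V L × X L × f L ≡ c) → A → ℚ
  lastSummand {f = f} _ = f

pathWeightSum-1 : ∀ W s t c (L : List (List Vertex)) → All (λ vs → pathWeight W s vs ≡ 1ℚ) L →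
  pathWeightSum W s t c L ≡ ι (length L)
pathWeightSum-1 W s t c []       []         = refl
pathWeightSum-1 W s t c (vs ∷ L) (w≡1 ∷ ws) =
  trans (cong₂ ℚ._+_ w≡1 (pathWeightSum-1 W s t c L ws)) (sym (ι-suc (length L)))

⟦_⟧ℚ : {A : Set} → Dec A → ℚ
⟦_⟧ℚ = indicator 1ℚ 0ℚ

⟦⟧ℚ-nonNegative : {A : Set} (a : Dec A) → 0ℚ ℚ.≤ ⟦ a ⟧ℚ
⟦⟧ℚ-nonNegative (yes _) = ι-mono-≤ {0} {1} z≤n
⟦⟧ℚ-nonNegative (no _)  = ℚP.≤-refl

⟦⟧ℚ-≢0 : {A : Set} (a : Dec A) → ⟦ a ⟧ℚ ≢ 0ℚ → A
⟦⟧ℚ-≢0 (yes x) _  = x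
⟦⟧ℚ-≢0 (no _)  ≢0 = ⊥-elim (≢0 refl)

translate : ∀ a {x x′ m m′} → x + m′ ≡ x′ + m → x ≡ a + m → x′ ≡ a + m′
translate a {x′ = x′} {m} {m′} x+m′≡x′+m refl = +-cancelʳ-≡ m x′ (a + m′) (begin
  x′ + m        ≡⟨ x+m′≡x′+m ⟨
  a + m + m′    ≡⟨ +-assoc a m m′ ⟩
  a + (m + m′)  ≡⟨ cong (a +_) (+-comm m m′) ⟩
  a + (m′ + m)  ≡⟨ +-assoc a m′ m ⟨
  a + m′ + m    ∎)
  where open ≡-Reasoning

_≟ᵥ_ : (u v : Vertex) → Dec (u ≡ v)
_≟ᵥ_ = ≡-dec _≟_ _≟_

module LatticeGraph (t : ℕ) where

  hop jump : Vertex → Vertex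
  hop  (m , k) = (suc m , k)
  jump (m , k) = (m + suc t , suc k)

  Step : Vertex → Vertex → Set
  Step u v = v ≡ hop u ⊎ v ≡ jump u

  step? : ∀ u v → Dec (Step u v)
  step? u v = (v ≟ᵥ hop u) ⊎-dec (v ≟ᵥ jump u)

  W : Weights
  W u v = ⟦ step? u v ⟧ℚ

  edge⇒step : ∀ {u v} → Edge W u v → Step u v
  edge⇒step {u} {v} = ⟦⟧ℚ-≢0 (step? u v)

  W-step : ∀ {u v} → Step u v → W u v ≡ 1ℚ
  W-step {u} {v} s = indicator-yes s (step? u v)

  step⇒edge : ∀ {u v} → Step u v → Edge W u v
  step⇒edge s W≡0 with () ← trans (sym (W-step s)) W≡0

  hop≢jump : ∀ u → hop u ≢ jump u
  hop≢jump (m , k) eq = 1+n≢n (sym (proj₂ (,-injective eq)))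

  step-advances : ∀ {u v} → Step u v → proj₁ u < proj₁ v
  step-advances {m , k} (inj₁ refl) = ≤-refl
  step-advances {m , k} (inj₂ refl) = subst (m <_) (sym (+-suc m t)) (s≤s (m≤m+n m t))

  nonNegative : NonNegative W
  nonNegative u v = ⟦⟧ℚ-nonNegative (step? u v)

  locallyFinite : LocallyFinite W
  locallyFinite (m , k) = (hop (m , k) ∷ jump (m , k) ∷ [] , outgoing) , (_ , incoming)
    where
    outgoing : ∀ v → Edge W (m , k) v → v ∈ hop (m , k) ∷ jump (m , k) ∷ []
    outgoing v edge with edge⇒step {m , k} {v} edge
    ... | inj₁ v≡hop  = here v≡hop
    ... | inj₂ v≡jump = there (here v≡jump)
    incoming : ∀ v → Edge W v (m , k) → v ∈ (m ∸ 1 , k) ∷ (m ∸ suc t , k ∸ 1) ∷ []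
    incoming (a , b) edge with edge⇒step {a , b} {m , k} edge
    ... | inj₁ refl = here refl
    ... | inj₂ refl = there (here (cong (_, b) (sym (m+n∸n≡m a (suc t)))))

  weaklyYInvariant : WeaklyYInvariant W
  weaklyYInvariant = invariant , (λ m k x y edge → <⇒≤ (step-advances (edge⇒step edge)))
    where
    invariant : ∀ m m′ k x x′ y → x + m′ ≡ x′ + m → W (m , k) (x , y) ≡ W (m′ , k) (x′ , y)
    invariant m m′ k x x′ y shift =
      indicator-cong (mk⇔ (moved shift) (moved (sym shift))) (step? (m , k) (x , y)) (step? (m′ , k) (x′ , y))
      where
      moved : ∀ {m m′ x x′} → x + m′ ≡ x′ + m → Step (m , k) (x , y) → Step (m′ , k) (x′ , y)
      moved shift (inj₁ refl) = inj₁ (cong (_, y) (translate 1 shift refl))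
      moved {m} {m′} shift (inj₂ refl) =
        inj₂ (cong (_, y) (trans (translate (suc t) shift (+-comm m (suc t))) (+-comm (suc t) m′)))

  pathWeight-1 : ∀ {u vs T} → IsPath W u vs T → pathWeight W u vs ≡ 1ℚ
  pathWeight-1 here                     = refl
  pathWeight-1 (step {u} {v} edge path) =
    trans (cong₂ ℚ._*_ (W-step (edge⇒step {u} {v} edge)) (pathWeight-1 path)) (ℚP.*-identityˡ 1ℚ)

  module Paths (N j : ℕ) where

    T : Vertex
    T = (N , j)

    arrived : Vertex → List (List Vertex)
    arrived u with u ≟ᵥ T
    ... | yes _ = [ [] ]
    ... | no _  = []

    pathsFrom : ℕ → Vertex → List (List Vertex)
    pathsFrom zero    u = arrived u
    pathsFrom (suc f) u =
      arrived u ++ map (hop u ∷_) (pathsFrom f (hop u)) ++ map (jump u ∷_) (pathsFrom f (jump u))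

    arrived-sound : ∀ u → All (λ vs → IsPath W u vs T) (arrived u)
    arrived-sound u with u ≟ᵥ T
    ... | yes refl = here ∷ []
    ... | no _     = []

    pathsFrom-sound : ∀ f u → All (λ vs → IsPath W u vs T) (pathsFrom f u)
    pathsFrom-sound zero    u = arrived-sound u
    pathsFrom-sound (suc f) u = All.++⁺ (arrived-sound u) (All.++⁺
      (All.map⁺ (All.map (step (step⇒edge {u} {hop u} (inj₁ refl))) (pathsFrom-sound f (hop u))))
      (All.map⁺ (All.map (step (step⇒edge {u} {jump u} (inj₂ refl))) (pathsFrom-sound f (jump u)))))

    arrived-unique : ∀ u → Unique (arrived u)
    arrived-unique u with u ≟ᵥ T
    ... | yes _ = [] ∷ []
    ... | no _  = []

    arrived-[] : ∀ {u vs} → vs ∈ arrived u → vs ≡ []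
    arrived-[] {u} vs∈ with u ≟ᵥ T
    arrived-[] (here vs≡[]) | yes _ = vs≡[]

    pathsFrom-unique : ∀ f u → Unique (pathsFrom f u)
    pathsFrom-unique zero    u = arrived-unique u
    pathsFrom-unique (suc f) u = Unique.++⁺ (arrived-unique u)
      (Unique.++⁺ (Unique.map⁺ ∷-injectiveʳ (pathsFrom-unique f (hop u)))
                  (Unique.map⁺ ∷-injectiveʳ (pathsFrom-unique f (jump u)))
                  hopsDisjointJumps)
      arrivedDisjointSteps
      where
      hopsDisjointJumps : ∀ {vs} →
        ¬ (vs ∈ map (hop u ∷_) (pathsFrom f (hop u)) × vs ∈ map (jump u ∷_) (pathsFrom f (jump u)))
      hopsDisjointJumps (viaHop , viaJump) with map∷⁻ viaHop | map∷⁻ viaJump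
      ... | _ , _ , refl | _ , _ , eq = hop≢jump u (proj₁ (∷-injective eq))
      arrivedDisjointSteps : ∀ {vs} →
        ¬ (vs ∈ arrived u × vs ∈ map (hop u ∷_) (pathsFrom f (hop u)) ++ map (jump u ∷_) (pathsFrom f (jump u)))
      arrivedDisjointSteps (arrival , viaStep) with arrived-[] arrival | ∈-++⁻ (map (hop u ∷_) (pathsFrom f (hop u))) viaStep
      ... | refl | inj₁ viaHop  = []∉map∷ viaHop
      ... | refl | inj₂ viaJump = []∉map∷ viaJump

    path-reach : ∀ {u vs} → IsPath W u vs T → proj₁ u + length vs ≤ N
    path-reach here = ≤-reflexive (+-identityʳ N)
    path-reach {u} (step {v = v} {vs} edge path) = begin
      proj₁ u + suc (length vs)   ≡⟨ +-suc (proj₁ u) (length vs) ⟩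
      suc (proj₁ u + length vs)   ≤⟨ +-monoˡ-≤ (length vs) (step-advances (edge⇒step {u} {v} edge)) ⟩
      proj₁ v + length vs         ≤⟨ path-reach path ⟩
      N                           ∎
      where open ≤-Reasoning

    arrived-T : [] ∈ arrived T
    arrived-T with T ≟ᵥ T
    ... | yes _   = here refl
    ... | no T≢T = ⊥-elim (T≢T refl)

    pathsFrom-complete : ∀ {u vs} → IsPath W u vs T → ∀ f → length vs ≤ f → vs ∈ pathsFrom f u
    pathsFrom-complete here zero    _ = arrived-T
    pathsFrom-complete here (suc f) _ = ∈-++⁺ˡ arrived-T
    pathsFrom-complete {u} (step {v = v} edge path) (suc f) (s≤s len≤f) with edge⇒step {u} {v} edge
    ... | inj₁ refl = ∈-++⁺ʳ (arrived u) (∈-++⁺ˡ (∈-map⁺ (hop u ∷_) (pathsFrom-complete path f len≤f)))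
    ... | inj₂ refl = ∈-++⁺ʳ (arrived u) (∈-++⁺ʳ (map (hop u ∷_) (pathsFrom f (hop u)))
                                                  (∈-map⁺ (jump u ∷_) (pathsFrom-complete path f len≤f)))

    length-arrived : ∀ u → length (arrived u) ≡ ⟦ u ≟ᵥ T ⟧
    length-arrived u with u ≟ᵥ T
    ... | yes _ = refl
    ... | no _  = refl

    length-pathsFrom-suc : ∀ f u → length (pathsFrom (suc f) u) ≡
      ⟦ u ≟ᵥ T ⟧ + (length (pathsFrom f (hop u)) + length (pathsFrom f (jump u)))
    length-pathsFrom-suc f u = begin
      length (arrived u ++ map (hop u ∷_) (pathsFrom f (hop u)) ++ map (jump u ∷_) (pathsFrom f (jump u)))
        ≡⟨ length-++ (arrived u) ⟩
      length (arrived u) + length (map (hop u ∷_) (pathsFrom f (hop u)) ++ map (jump u ∷_) (pathsFrom f (jump u)))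
        ≡⟨ cong₂ _+_ (length-arrived u) (length-++ (map (hop u ∷_) (pathsFrom f (hop u)))) ⟩
      ⟦ u ≟ᵥ T ⟧ + (length (map (hop u ∷_) (pathsFrom f (hop u))) + length (map (jump u ∷_) (pathsFrom f (jump u))))
        ≡⟨ cong (⟦ u ≟ᵥ T ⟧ +_) (cong₂ _+_ (length-map (hop u ∷_) (pathsFrom f (hop u)))
                                           (length-map (jump u ∷_) (pathsFrom f (jump u)))) ⟩
      ⟦ u ≟ᵥ T ⟧ + (length (pathsFrom f (hop u)) + length (pathsFrom f (jump u))) ∎
      where open ≡-Reasoning

    Beyond : Vertex → Set
    Beyond (m , k) = N < m ⊎ j < k

    beyond≢T : ∀ {u} → Beyond u → u ≢ T
    beyond≢T (inj₁ N<N) refl = <-irrefl refl N<N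
    beyond≢T (inj₂ j<j) refl = <-irrefl refl j<j

    length-pathsFrom-beyond : ∀ f u → Beyond u → length (pathsFrom f u) ≡ 0
    length-pathsFrom-beyond zero    u beyond = trans (length-arrived u) (indicator-no (beyond≢T beyond) (u ≟ᵥ T))
    length-pathsFrom-beyond (suc f) (m , k) beyond = begin
      length (pathsFrom (suc f) (m , k))
        ≡⟨ length-pathsFrom-suc f (m , k) ⟩
      ⟦ (m , k) ≟ᵥ T ⟧ + (length (pathsFrom f (hop (m , k))) + length (pathsFrom f (jump (m , k))))
        ≡⟨ cong₂ _+_ (indicator-no (beyond≢T beyond) ((m , k) ≟ᵥ T))
                     (cong₂ _+_ (length-pathsFrom-beyond f _ (beyondHop beyond)) (length-pathsFrom-beyond f _ (beyondJump beyond))) ⟩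
      0 ∎
      where
      open ≡-Reasoning
      beyondHop : Beyond (m , k) → Beyond (hop (m , k))
      beyondHop (inj₁ N<m) = inj₁ (m<n⇒m<1+n N<m)
      beyondHop (inj₂ j<k) = inj₂ j<k
      beyondJump : Beyond (m , k) → Beyond (jump (m , k))
      beyondJump (inj₁ N<m) = inj₁ (<-≤-trans N<m (m≤m+n m (suc t)))
      beyondJump (inj₂ j<k) = inj₂ (m<n⇒m<1+n j<k)

    arrived-count : ∀ k b → k + b ≡ j → ⟦ (N , k) ≟ᵥ T ⟧ ≡ (0 ∸ t * b) C b
    arrived-count k zero    k+0≡j = indicator-yes (cong (N ,_) (trans (sym (+-identityʳ k)) k+0≡j)) ((N , k) ≟ᵥ T)
    arrived-count k (suc b) k+b≡j rewrite 0∸n≡0 (t * suc b) =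
      indicator-no (λ eq → m≢1+m+n k (trans (proj₂ (,-injective eq)) (trans (sym k+b≡j) (+-suc k b)))) ((N , k) ≟ᵥ T)

    length-pathsFrom-lastColumn : ∀ f k b → k + b ≡ j → length (pathsFrom f (N , k)) ≡ (0 ∸ t * b) C b
    length-pathsFrom-lastColumn zero    k b k+b≡j = trans (length-arrived (N , k)) (arrived-count k b k+b≡j)
    length-pathsFrom-lastColumn (suc f) k b k+b≡j = begin
      length (pathsFrom (suc f) (N , k))
        ≡⟨ length-pathsFrom-suc f (N , k) ⟩
      ⟦ (N , k) ≟ᵥ T ⟧ + (length (pathsFrom f (suc N , k)) + length (pathsFrom f (N + suc t , suc k)))
        ≡⟨ cong (⟦ (N , k) ≟ᵥ T ⟧ +_) (cong₂ _+_ (length-pathsFrom-beyond f _ (inj₁ ≤-refl))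
                                                 (length-pathsFrom-beyond f _ (inj₁ (m<m+n N (s≤s z≤n))))) ⟩
      ⟦ (N , k) ≟ᵥ T ⟧ + 0
        ≡⟨ +-identityʳ _ ⟩
      ⟦ (N , k) ≟ᵥ T ⟧
        ≡⟨ arrived-count k b k+b≡j ⟩
      (0 ∸ t * b) C b ∎
      where open ≡-Reasoning

    length-pathsFrom-notT : ∀ f m k → (m , k) ≢ T →
      length (pathsFrom (suc f) (m , k)) ≡ length (pathsFrom f (suc m , k)) + length (pathsFrom f (m + suc t , suc k))
    length-pathsFrom-notT f m k m,k≢T =
      trans (length-pathsFrom-suc f (m , k))
            (cong (_+ (length (pathsFrom f (suc m , k)) + length (pathsFrom f (m + suc t , suc k))))
                  (indicator-no m,k≢T ((m , k) ≟ᵥ T)))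

    notT : ∀ {m a k} → m + suc a ≡ N → (m , k) ≢ T
    notT {m} {a} m+a≡N refl = m≢1+m+n m (trans (sym m+a≡N) (+-suc m a))

    hopReach : ∀ {m a} → m + suc a ≡ N → suc m + a ≡ N
    hopReach {m} {a} m+a≡N = trans (sym (+-suc m a)) m+a≡N

    length-pathsFrom : ∀ f a b m k → a ≤ f → m + a ≡ N → k + b ≡ j → length (pathsFrom f (m , k)) ≡ (a ∸ t * b) C b
    length-pathsFrom f zero b m k _ m+0≡N k+b≡j with trans (sym (+-identityʳ m)) m+0≡N
    ... | refl = length-pathsFrom-lastColumn f k b k+b≡j
    length-pathsFrom (suc f) (suc a) zero m k (s≤s a≤f) m+a≡N k+0≡j = begin
      length (pathsFrom (suc f) (m , k))
        ≡⟨ length-pathsFrom-notT f m k (notT m+a≡N) ⟩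
      length (pathsFrom f (suc m , k)) + length (pathsFrom f (m + suc t , suc k))
        ≡⟨ cong₂ _+_ (length-pathsFrom f a zero (suc m) k a≤f (hopReach m+a≡N) k+0≡j)
                     (length-pathsFrom-beyond f _ (inj₂ (subst (_< suc k) (trans (sym (+-identityʳ k)) k+0≡j) ≤-refl))) ⟩
      1 + 0 ∎
      where open ≡-Reasoning
    length-pathsFrom (suc f) (suc a) (suc b) m k (s≤s a≤f) m+a≡N k+b≡j with t ≤? a
    ... | yes t≤a = begin
      length (pathsFrom (suc f) (m , k))
        ≡⟨ length-pathsFrom-notT f m k (notT m+a≡N) ⟩
      length (pathsFrom f (suc m , k)) + length (pathsFrom f (m + suc t , suc k))
        ≡⟨ cong₂ _+_ (length-pathsFrom f a (suc b) (suc m) k a≤f (hopReach m+a≡N) k+b≡j)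
                     (length-pathsFrom f (a ∸ t) b (m + suc t) (suc k) (≤-trans (m∸n≤m a t) a≤f) jumpReach
                                       (trans (sym (+-suc k b)) k+b≡j)) ⟩
      (a ∸ t * suc b) C suc b + ((a ∸ t) ∸ t * b) C b
        ≡⟨ lattice-pascal t a b t≤a ⟩
      (suc a ∸ t * suc b) C suc b ∎
      where
      open ≡-Reasoning
      jumpReach : m + suc t + (a ∸ t) ≡ N
      jumpReach = trans (+-assoc m (suc t) (a ∸ t)) (trans (cong (λ s → m + suc s) (m+[n∸m]≡n t≤a)) m+a≡N)
    ... | no t≰a = begin
      length (pathsFrom (suc f) (m , k))
        ≡⟨ length-pathsFrom-notT f m k (notT m+a≡N) ⟩
      length (pathsFrom f (suc m , k)) + length (pathsFrom f (m + suc t , suc k))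
        ≡⟨ cong₂ _+_ (length-pathsFrom f a (suc b) (suc m) k a≤f (hopReach m+a≡N) k+b≡j)
                     (length-pathsFrom-beyond f _ (inj₁ (subst (_< m + suc t) m+a≡N (+-monoʳ-< m (s≤s (≰⇒> t≰a)))))) ⟩
      (a ∸ t * suc b) C suc b + 0
        ≡⟨ +-identityʳ _ ⟩
      (a ∸ t * suc b) C suc b
        ≡⟨ lattice-pascal-short t a b (≰⇒> t≰a) ⟩
      (suc a ∸ t * suc b) C suc b ∎
      where open ≡-Reasoning

    pathCount : PathCount W (0 , 0) T (ι ((N ∸ t * j) C j))
    pathCount =
      pathsFrom N (0 , 0) , pathsFrom-unique N (0 , 0) , pathsFrom-sound N (0 , 0) ,
      (λ vs path → pathsFrom-complete path N (path-reach path)) ,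
      trans (pathWeightSum-1 W (0 , 0) T (ι ((N ∸ t * j) C j)) (pathsFrom N (0 , 0)) (All.map pathWeight-1 (pathsFrom-sound N (0 , 0))))
            (cong ι (length-pathsFrom N N j 0 0 ≤-refl refl refl))

  -- Planarity

  OnHop : Point → ℕ → ℕ → Set
  OnHop (x , y) m k = Σ ℚ λ s → 0ℚ ℚ.≤ s × s ℚ.≤ 1ℚ × x ≡ ι m ℚ.+ s × y ≡ ι k

  OnJump : Point → ℕ → ℕ → Set
  OnJump (x , y) m k = Σ ℚ λ s → 0ℚ ℚ.≤ s × s ℚ.≤ 1ℚ × x ≡ ι m ℚ.+ s ℚ.* ι (suc t) × y ≡ ι k ℚ.+ s

  private
    open +-*-Solver

    unitSegment : ∀ x s → x ℚ.+ s ℚ.* ((1ℚ ℚ.+ x) ℚ.- x) ≡ x ℚ.+ s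
    unitSegment = solve 2 (λ x s → x :+ s :* ((con 1ℚ :+ x) :- x) := x :+ s) refl

    constantSegment : ∀ x s → x ℚ.+ s ℚ.* (x ℚ.- x) ≡ x
    constantSegment = solve 2 (λ x s → x :+ s :* (x :- x) := x) refl

    scaledSegment : ∀ x d s → x ℚ.+ s ℚ.* ((x ℚ.+ d) ℚ.- x) ≡ x ℚ.+ s ℚ.* d
    scaledSegment = solve 3 (λ x d s → x :+ s :* ((x :+ d) :- x) := x :+ s :* d) refl

  onSegment-hop : ∀ p m k → OnSegment p (m , k) (hop (m , k)) → OnHop p m k
  onSegment-hop (x , y) m k (s , 0≤s , s≤1 , x≡ , y≡) =
    s , 0≤s , s≤1 ,
    trans x≡ (trans (cong (λ e → ι m ℚ.+ s ℚ.* (e ℚ.- ι m)) (ι-suc m)) (unitSegment (ι m) s)) ,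
    trans y≡ (constantSegment (ι k) s)

  onSegment-jump : ∀ p m k → OnSegment p (m , k) (jump (m , k)) → OnJump p m k
  onSegment-jump (x , y) m k (s , 0≤s , s≤1 , x≡ , y≡) =
    s , 0≤s , s≤1 ,
    trans x≡ (trans (cong (λ e → ι m ℚ.+ s ℚ.* (e ℚ.- ι m)) (ι-+ m (suc t))) (scaledSegment (ι m) (ι (suc t)) s)) ,
    trans y≡ (trans (cong (λ e → ι k ℚ.+ s ℚ.* (e ℚ.- ι k)) (ι-suc k)) (unitSegment (ι k) s))

  pt-injective : ∀ {u v} → pt u ≡ pt v → u ≡ v
  pt-injective eq = cong₂ _,_ (ι-injective (proj₁ (,-injective eq))) (ι-injective (proj₂ (,-injective eq)))

  jumpEndpoint : ∀ {x y} m k s → x ≡ ι m ℚ.+ s ℚ.* ι (suc t) → y ≡ ι k ℚ.+ s → s ≡ 0ℚ ⊎ s ≡ 1ℚ →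
    (x , y) ≡ pt (m , k) ⊎ (x , y) ≡ pt (jump (m , k))
  jumpEndpoint m k s x≡ y≡ (inj₁ s≡0) = inj₁ (cong₂ _,_
    (trans x≡ (trans (cong (λ r → ι m ℚ.+ r ℚ.* ι (suc t)) s≡0)
                     (trans (cong (ι m ℚ.+_) (ℚP.*-zeroˡ (ι (suc t)))) (ℚP.+-identityʳ (ι m)))))
    (trans y≡ (trans (cong (ι k ℚ.+_) s≡0) (ℚP.+-identityʳ (ι k)))))
  jumpEndpoint m k s x≡ y≡ (inj₂ s≡1) = inj₂ (cong₂ _,_
    (trans x≡ (trans (cong (λ r → ι m ℚ.+ r ℚ.* ι (suc t)) s≡1)
                     (trans (cong (ι m ℚ.+_) (ℚP.*-identityˡ (ι (suc t)))) (sym (ι-+ m (suc t))))))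
    (trans y≡ (trans (cong (ι k ℚ.+_) s≡1) (trans (ℚP.+-comm (ι k) 1ℚ) (sym (ι-suc k))))))

  latticeOnHop : ∀ m k z → OnHop (pt z) m k → z ≡ (m , k) ⊎ z ≡ hop (m , k)
  latticeOnHop m k (zx , zy) (s , 0≤s , s≤1 , x≡ , y≡) =
    Sum.map (λ (zx≡m , _) → cong₂ _,_ zx≡m zy≡k) (λ (zx≡1+m , _) → cong₂ _,_ zx≡1+m zy≡k)
            (ι-unitStep {zx} {m} x≡ 0≤s s≤1)
    where
    zy≡k : zy ≡ k
    zy≡k = ι-injective y≡

  latticeOnJump : ∀ m k z → OnJump (pt z) m k → z ≡ (m , k) ⊎ z ≡ jump (m , k)
  latticeOnJump m k z (s , 0≤s , s≤1 , x≡ , y≡) = Sum.map pt-injective pt-injective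
    (jumpEndpoint m k s x≡ y≡ (Sum.map proj₂ proj₂ (ι-unitStep {proj₂ z} {k} y≡ 0≤s s≤1)))

  latticeOnEdge : ∀ u v z → Edge W u v → OnSegment (pt z) u v → z ≡ u ⊎ z ≡ v
  latticeOnEdge (m , k) v z edge onSegment = byStep (edge⇒step {m , k} {v} edge) onSegment
    where
    byStep : Step (m , k) v → OnSegment (pt z) (m , k) v → z ≡ (m , k) ⊎ z ≡ v
    byStep (inj₁ refl) onHop  = latticeOnHop m k z (onSegment-hop (pt z) m k onHop)
    byStep (inj₂ refl) onJump = latticeOnJump m k z (onSegment-jump (pt z) m k onJump)

  Lattice : Point → Set
  Lattice p = Σ Vertex λ z → p ≡ pt z

  endpointLattice : ∀ {p} u v → p ≡ pt u ⊎ p ≡ pt v → Lattice p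
  endpointLattice u v (inj₁ p≡u) = u , p≡u
  endpointLattice u v (inj₂ p≡v) = v , p≡v

  hopCrossesHop : ∀ p m k m′ k′ → (m , k) ≢ (m′ , k′) → OnHop p m k → OnHop p m′ k′ → Lattice p
  hopCrossesHop (x , y) m k m′ k′ distinct (s , 0≤s , s≤1 , x≡ , y≡) (s′ , 0≤s′ , s′≤1 , x≡′ , y≡′) =
    byColumn (<-cmp m m′)
    where
    byColumn : Tri (m < m′) (m ≡ m′) (m′ < m) → Lattice (x , y)
    byColumn (tri< m<m′ _ _) =
      (suc m , k) , cong₂ _,_ (trans x≡ (ι-unitSteps-overlap m<m′ 0≤s′ s≤1 (trans (sym x≡) x≡′))) y≡
    byColumn (tri≈ _ m≡m′ _) = ⊥-elim (distinct (cong₂ _,_ m≡m′ (ι-injective (trans (sym y≡) y≡′))))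
    byColumn (tri> _ _ m′<m) =
      (suc m′ , k′) , cong₂ _,_ (trans x≡′ (ι-unitSteps-overlap m′<m 0≤s s′≤1 (trans (sym x≡′) x≡))) y≡′

  hopCrossesJump : ∀ p m k m′ k′ → OnHop p m k → OnJump p m′ k′ → Lattice p
  hopCrossesJump (x , y) m k m′ k′ (_ , _ , _ , _ , y≡) (s′ , 0≤s′ , s′≤1 , x≡′ , y≡′) =
    endpointLattice (m′ , k′) (jump (m′ , k′)) (jumpEndpoint m′ k′ s′ x≡′ y≡′
      (Sum.map proj₂ proj₂ (ι-unitStep {k} {k′} (trans (sym y≡) y≡′) 0≤s′ s′≤1)))

  jumpCrossesJump : ∀ p m k m′ k′ → (m , k) ≢ (m′ , k′) → OnJump p m k → OnJump p m′ k′ → Lattice p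
  jumpCrossesJump (x , y) m k m′ k′ distinct (s , 0≤s , s≤1 , x≡ , y≡) (s′ , 0≤s′ , s′≤1 , x≡′ , y≡′) =
    byRow (<-cmp k k′)
    where
    sameHeight : ι k ℚ.+ s ≡ ι k′ ℚ.+ s′
    sameHeight = trans (sym y≡) y≡′
    byRow : Tri (k < k′) (k ≡ k′) (k′ < k) → Lattice (x , y)
    byRow (tri< k<k′ _ _) = endpointLattice (m , k) (jump (m , k)) (jumpEndpoint m k s x≡ y≡
      (Sum.map proj₂ proj₂ (ι-unitStep {suc k} {k} (sym (ι-unitSteps-overlap k<k′ 0≤s′ s≤1 sameHeight)) 0≤s s≤1)))
    byRow (tri≈ _ k≡k′ _) = ⊥-elim (distinct (cong₂ _,_ m≡m′ k≡k′))
      where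
      s≡s′ : s ≡ s′
      s≡s′ = ℚ-+-cancelˡ (ι k) s s′ (trans sameHeight (cong (λ i → ι i ℚ.+ s′) (sym k≡k′)))
      m≡m′ : m ≡ m′
      m≡m′ = ι-injective (ℚ-+-cancelʳ (s′ ℚ.* ι (suc t)) (ι m) (ι m′)
        (trans (cong (λ r → ι m ℚ.+ r ℚ.* ι (suc t)) (sym s≡s′)) (trans (sym x≡) x≡′)))
    byRow (tri> _ _ k′<k) = endpointLattice (m′ , k′) (jump (m′ , k′)) (jumpEndpoint m′ k′ s′ x≡′ y≡′
      (Sum.map proj₂ proj₂ (ι-unitStep {suc k′} {k′} (sym (ι-unitSteps-overlap k′<k 0≤s s′≤1 (sym sameHeight))) 0≤s′ s′≤1)))

  edgesMeetAtLattice : ∀ u v u′ v′ → Edge W u v → Edge W u′ v′ → (u , v) ≢ (u′ , v′) →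
    ∀ p → OnSegment p u v → OnSegment p u′ v′ → Lattice p
  edgesMeetAtLattice (m , k) v (m′ , k′) v′ edge edge′ distinct p =
    bySteps (edge⇒step {m , k} {v} edge) (edge⇒step {m′ , k′} {v′} edge′) distinct
    where
    bySteps : Step (m , k) v → Step (m′ , k′) v′ → ((m , k) , v) ≢ ((m′ , k′) , v′) →
      OnSegment p (m , k) v → OnSegment p (m′ , k′) v′ → Lattice p
    bySteps (inj₁ refl) (inj₁ refl) distinct on on′ = hopCrossesHop p m k m′ k′
      (distinct ∘ cong (λ u → u , hop u)) (onSegment-hop p m k on) (onSegment-hop p m′ k′ on′)
    bySteps (inj₁ refl) (inj₂ refl) _        on on′ = hopCrossesJump p m k m′ k′
      (onSegment-hop p m k on) (onSegment-jump p m′ k′ on′)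
    bySteps (inj₂ refl) (inj₁ refl) _        on on′ = hopCrossesJump p m′ k′ m k
      (onSegment-hop p m′ k′ on′) (onSegment-jump p m k on)
    bySteps (inj₂ refl) (inj₂ refl) distinct on on′ = jumpCrossesJump p m k m′ k′
      (distinct ∘ cong (λ u → u , jump u)) (onSegment-jump p m k on) (onSegment-jump p m′ k′ on′)

  planar : Planar W
  planar = crossing , latticeOnEdge
    where
    crossing : ∀ u v u′ v′ → Edge W u v → Edge W u′ v′ → (u , v) ≢ (u′ , v′) →
      ∀ p → OnSegment p u v → OnSegment p u′ v′ →
      Σ Vertex λ z → (p ≡ pt z) × (z ≡ u ⊎ z ≡ v) × (z ≡ u′ ⊎ z ≡ v′)
    crossing u v u′ v′ edge edge′ distinct p on on′ with edgesMeetAtLattice u v u′ v′ edge edge′ distinct p on on′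
    ... | z , refl = z , refl , latticeOnEdge u v z edge on , latticeOnEdge u′ v′ z edge′ on′

BrentiSequence-cong : ∀ {P Q : ℕ → ℕ → ℕ} → (∀ n j → P n j ≡ Q n j) → BrentiSequence P → BrentiSequence Q
BrentiSequence-cong P≗Q (W , nonNegative , locallyFinite , planar , invariant , r , count) =
  W , nonNegative , locallyFinite , planar , invariant , r ,
  λ n 1≤n j → subst (PathCount W (0 , 0) (r n , j)) (cong ι (P≗Q n j)) (count n 1≤n j)

binomial-brenti : ∀ d ℓ → BrentiSequence (λ n j → (d * (n ∸ j * ℓ)) C j)
binomial-brenti d ℓ =
  W , nonNegative , locallyFinite , planar , weaklyYInvariant , (d *_) ,
  λ n _ j → subst (PathCount W (0 , 0) (d * n , j)) (cong (λ m → ι (m C j)) (row n j)) (Paths.pathCount (d * n) j)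
  where
  open LatticeGraph (d * ℓ)
  row : ∀ n j → d * n ∸ d * ℓ * j ≡ d * (n ∸ j * ℓ)
  row n j = begin
    d * n ∸ d * ℓ * j     ≡⟨ cong (d * n ∸_) (*-assoc d ℓ j) ⟩
    d * n ∸ d * (ℓ * j)   ≡⟨ cong (λ m → d * n ∸ d * m) (*-comm ℓ j) ⟩
    d * n ∸ d * (j * ℓ)   ≡⟨ *-distribˡ-∸ d n (j * ℓ) ⟨
    d * (n ∸ j * ℓ)       ∎
    where open ≡-Reasoning

partition-antitone : ∀ {ℓ μ} → IsPartition ℓ μ → ∀ {i j} → i ≤ j → j ≤ ℓ → μ j ≤ μ i
partition-antitone partition {j = zero}  z≤n   _     = ≤-refl
partition-antitone partition {i} {suc j} i≤1+j 1+j≤ℓ with m≤n⇒m<n∨m≡n i≤1+j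
... | inj₂ refl      = ≤-refl
... | inj₁ (s≤s i≤j) = ≤-trans (proj₁ partition j 1+j≤ℓ) (partition-antitone partition i≤j (<⇒≤ 1+j≤ℓ))

theorem4p26 : (ℓ : ℕ) (μ : ℕ → ℕ) (d : ℕ) →
    IsPartition ℓ μ → 1 ≤ ℓ → 1 ≤ d → d ≤ μ 0 → μ ℓ ≡ 1 → d ≤ μ (ℓ ∸ 1) →
    (∀ n j → Pcoef ℓ μ d n j ≡ (d * (n ∸ j * ℓ)) C j)
    × BrentiSequence (Pcoef ℓ μ d)
theorem4p26 zero    μ d _         ()  _ _ _      _
theorem4p26 (suc c) μ d partition _   _ _ μ-last d≤μc =
  Pcoef≡binomial , BrentiSequence-cong (λ n j → sym (Pcoef≡binomial n j)) (binomial-brenti d (suc c))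
  where
  open AnchorCount c μ d (λ k k<c → ≤-trans d≤μc (partition-antitone partition k<c (n≤1+n c))) μ-last
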